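{- For every $b>0$ there exist $c>0$ and $n_0\in\mathbb{Z}_{>0}$ such that $DM(n)\geq c\,b^n$ for all $n>n_0$; that is, $DM(n)=\Omega(b^n)$ for every $b>0$.
   Context: A distance monoid is a structure $(R,\oplus,\leq,0)$ such that: $\leq$ is a total order on $R$; $r\leq r\oplus s$ for all $r,s$; if $r\leq t$ and $s\leq u$ then $r\oplus s\leq t\oplus u$; $\oplus$ is commutative and associative; and $r\oplus 0=r$ for all $r$. $DM(n)$ denotes the number of distance monoids (up to isomorphism of ordered monoids) with exactly $n$ non-zero elements.
   Formalization: The base b ranges over the positive rationals, and the constant c is taken in the rationals. -}

module Defs where

open import Level using (suc; zero)
open import Data.Nat as ℕ using (ℕ)
open import Data.Fin using (Fin)
open import Data.Integer using (+_)
open import Data.Rational using (ℚ; 1ℚ; _*_)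
open import Data.Product using (Σ; _×_)
open import Function.Bundles using (_↔_; Inverse)
open import Relation.Binary.PropositionalEquality using (_≡_; _≢_)
open import Relation.Binary.Structures using (IsTotalOrder)
open import Relation.Nullary using (¬_)

record DistanceMonoid (n : ℕ) : Set₁ where
  field
    Carrier : Set
    _⊕_     : Carrier → Carrier → Carrier
    _≤_     : Carrier → Carrier → Set
    𝟘       : Carrier
    isTotalOrder : IsTotalOrder _≡_ _≤_
    ≤-⊕      : ∀ r s → r ≤ (r ⊕ s)
    ⊕-mono   : ∀ {r s t u} → r ≤ t → s ≤ u → (r ⊕ s) ≤ (t ⊕ u)
    ⊕-comm   : ∀ r s → (r ⊕ s) ≡ (s ⊕ r)
    ⊕-assoc  : ∀ r s t → ((r ⊕ s) ⊕ t) ≡ (r ⊕ (s ⊕ t))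
    ⊕-identityʳ : ∀ r → (r ⊕ 𝟘) ≡ r
    nonzero-count : Σ Carrier (λ r → r ≢ 𝟘) ↔ Fin n

record Iso {n m : ℕ} (M : DistanceMonoid n) (N : DistanceMonoid m) : Set where
  private
    module M = DistanceMonoid M
    module N = DistanceMonoid N
  field
    bij       : M.Carrier ↔ N.Carrier
  open Inverse bij public using (to)
  field
    to-𝟘      : to M.𝟘 ≡ N.𝟘
    to-⊕      : ∀ r s → to (r M.⊕ s) ≡ (to r N.⊕ to s)
    to-mono   : ∀ {r s} → r M.≤ s → to r N.≤ to s
    to-reflect : ∀ {r s} → to r N.≤ to s → r M.≤ s

-- "DM(n) ≥ k": there are k pairwise non-isomorphic distance monoids
-- with exactly n non-zero elements.
AtLeastDM : ℕ → ℕ → Set₁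
AtLeastDM n k = Σ (Fin k → DistanceMonoid n)
  (λ f → ∀ i j → i ≢ j → ¬ Iso (f i) (f j))

_^ℚ_ : ℚ → ℕ → ℚ
b ^ℚ ℕ.zero = 1ℚ
b ^ℚ ℕ.suc n = b * (b ^ℚ n)

toℚ : ℕ → ℚ
toℚ k = Data.Rational._/_ (+ k) 1

-- Fix m with 5m < n and any e : ℕ → ℕ → {0,1}. On the chain {0,…,n}, with 0 neutral, put
-- x ⊕ y = m + 2(x + y) + e(min x y, max x y) when 0 < x, y ≤ m, and x ⊕ y = n as soon as x or y
-- exceeds m. A sum of two non-zero elements exceeds m, so every sum of three non-zero elements
-- is n and associativity comes for free; an increase of x + y raises m + 2(x + y) by at least 2,
-- which the 0/1 perturbation e cannot undo, so ⊕ is monotone. An isomorphism of two such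
-- monoids is an order automorphism of a finite chain, hence the identity, so it forces the two
-- perturbations to agree. Taking m = 2a + 1 and e the indicator of the graph of a map
-- {1,…,a} → {a+1,…,2a+1} yields (a+1)^a pairwise non-isomorphic distance monoids, which for
-- a = ⌊n/16⌋ outgrows every exponential b^n.

module Submission where

open import Defs
open import Data.Nat using (ℕ; _>_)
open import Data.Product using (Σ; _×_; _,_; ∃-syntax)

module Construction where

  open import Data.Nat
  open import Data.Nat.Properties
  open import Data.Nat.DivMod using (m≡m%n+[m/n]*n; m%n<n; m*n/n≡m; /-monoˡ-≤; m/n*n≤m)
  open import Data.Nat.Tactic.RingSolver using (solve-∀)
  open import Data.Fin as Fin using (Fin; toℕ; fromℕ; fromℕ<; inject₁; finToFun; funToFin; combine)
  open import Data.Fin.Properties as Finₚ using (toℕ-injective; toℕ-inject₁; toℕ-fromℕ<; toℕ≤pred[n]; ≤fromℕ; ≤̄⇒inject₁<; funToFin-finToFin)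
  open import Data.Fin.Induction using (<-weakInduction; >-weakInduction)
  open import Function using (_∘_)
  open import Function.Bundles using (mk↔ₛ′)
  open import Relation.Binary.PropositionalEquality
  open import Relation.Nullary using (Dec; yes; no; contradiction; _×-dec_)

  module _ {k : ℕ} (f : Fin (suc k) → Fin (suc k))
           (f-strict : ∀ {x y} → x Fin.< y → f x Fin.< f y) where

    private
      f-step : ∀ i → toℕ (f (inject₁ i)) < toℕ (f (Fin.suc i))
      f-step i = f-strict (≤̄⇒inject₁< Finₚ.≤-refl)

    strictMono⇒inflationary : ∀ x → x Fin.≤ f x
    strictMono⇒inflationary = <-weakInduction (λ x → x Fin.≤ f x) z≤n step
      where
      open ≤-Reasoning
      step : ∀ i → inject₁ i Fin.≤ f (inject₁ i) → Fin.suc i Fin.≤ f (Fin.suc i)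
      step i i≤fi = begin-strict
        toℕ i               ≡⟨ toℕ-inject₁ i ⟨
        toℕ (inject₁ i)     ≤⟨ i≤fi ⟩
        toℕ (f (inject₁ i)) <⟨ f-step i ⟩
        toℕ (f (Fin.suc i)) ∎

    strictMono⇒deflationary : ∀ x → f x Fin.≤ x
    strictMono⇒deflationary = >-weakInduction (λ x → f x Fin.≤ x) (≤fromℕ (f (fromℕ k))) step
      where
      open ≤-Reasoning
      step : ∀ i → f (Fin.suc i) Fin.≤ Fin.suc i → f (inject₁ i) Fin.≤ inject₁ i
      step i fi≤i = s≤s⁻¹ (begin-strict
        toℕ (f (inject₁ i))   <⟨ f-step i ⟩
        toℕ (f (Fin.suc i))   ≤⟨ fi≤i ⟩
        suc (toℕ i)           ≡⟨ cong suc (toℕ-inject₁ i) ⟨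
        suc (toℕ (inject₁ i)) ∎)

    strictMono⇒≡id : ∀ x → f x ≡ x
    strictMono⇒≡id x = Finₚ.≤-antisym (strictMono⇒deflationary x) (strictMono⇒inflationary x)

  reflecting⇒≡id : ∀ {k} (f : Fin (suc k) → Fin (suc k)) →
                   (∀ {x y} → f x Fin.≤ f y → x Fin.≤ y) → ∀ x → f x ≡ x
  reflecting⇒≡id f f-reflects = strictMono⇒≡id f (λ x<y → ≰⇒> (<⇒≱ x<y ∘ f-reflects))

  record BoundedDistanceOperation (n : ℕ) : Set where
    field
      _∙_         : ℕ → ℕ → ℕ
      ∙-closed    : ∀ {x y} → x ≤ n → y ≤ n → x ∙ y ≤ n
      ∙-comm      : ∀ x y → x ∙ y ≡ y ∙ x
      ∙-assoc     : ∀ x y z → (x ∙ y) ∙ z ≡ x ∙ (y ∙ z)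
      ∙-identityʳ : ∀ x → x ∙ 0 ≡ x
      ∙-mono      : ∀ {x y t u} → x ≤ t → y ≤ u → t ≤ n → u ≤ n → x ∙ y ≤ t ∙ u

    _⊕_ : Fin (suc n) → Fin (suc n) → Fin (suc n)
    x ⊕ y = fromℕ< (s≤s (∙-closed (toℕ≤pred[n] x) (toℕ≤pred[n] y)))

    toℕ-⊕ : ∀ x y → toℕ (x ⊕ y) ≡ toℕ x ∙ toℕ y
    toℕ-⊕ x y = toℕ-fromℕ< _

    ⊕-comm : ∀ x y → x ⊕ y ≡ y ⊕ x
    ⊕-comm x y = toℕ-injective (begin
      toℕ (x ⊕ y)   ≡⟨ toℕ-⊕ x y ⟩
      toℕ x ∙ toℕ y ≡⟨ ∙-comm (toℕ x) (toℕ y) ⟩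
      toℕ y ∙ toℕ x ≡⟨ toℕ-⊕ y x ⟨
      toℕ (y ⊕ x)   ∎)
      where open ≡-Reasoning

    ⊕-assoc : ∀ x y z → (x ⊕ y) ⊕ z ≡ x ⊕ (y ⊕ z)
    ⊕-assoc x y z = toℕ-injective (begin
      toℕ ((x ⊕ y) ⊕ z)           ≡⟨ toℕ-⊕ (x ⊕ y) z ⟩
      toℕ (x ⊕ y) ∙ toℕ z         ≡⟨ cong (_∙ toℕ z) (toℕ-⊕ x y) ⟩
      (toℕ x ∙ toℕ y) ∙ toℕ z     ≡⟨ ∙-assoc (toℕ x) (toℕ y) (toℕ z) ⟩
      toℕ x ∙ (toℕ y ∙ toℕ z)     ≡⟨ cong (toℕ x ∙_) (toℕ-⊕ y z) ⟨
      toℕ x ∙ toℕ (y ⊕ z)         ≡⟨ toℕ-⊕ x (y ⊕ z) ⟨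
      toℕ (x ⊕ (y ⊕ z))           ∎)
      where open ≡-Reasoning

    ⊕-identityʳ : ∀ x → x ⊕ Fin.zero ≡ x
    ⊕-identityʳ x = toℕ-injective (trans (toℕ-⊕ x Fin.zero) (∙-identityʳ (toℕ x)))

    ⊕-mono : ∀ {x y t u} → x Fin.≤ t → y Fin.≤ u → x ⊕ y Fin.≤ t ⊕ u
    ⊕-mono {x} {y} {t} {u} x≤t y≤u = subst₂ _≤_ (sym (toℕ-⊕ x y)) (sym (toℕ-⊕ t u))
      (∙-mono x≤t y≤u (toℕ≤pred[n] t) (toℕ≤pred[n] u))

    ≤-⊕ : ∀ x y → x Fin.≤ x ⊕ y
    ≤-⊕ x y = subst (Fin._≤ x ⊕ y) (⊕-identityʳ x) (⊕-mono {x} {Fin.zero} Finₚ.≤-refl z≤n)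

    private
      nonzero⇒Fin : Σ (Fin (suc n)) (_≢ Fin.zero) → Fin n
      nonzero⇒Fin (Fin.zero  , 0≢0) = contradiction refl 0≢0
      nonzero⇒Fin (Fin.suc i , _)   = i

      Fin⇒nonzero : Fin n → Σ (Fin (suc n)) (_≢ Fin.zero)
      Fin⇒nonzero i = Fin.suc i , λ ()

      Fin⇒nonzero-nonzero⇒Fin : ∀ x → Fin⇒nonzero (nonzero⇒Fin x) ≡ x
      Fin⇒nonzero-nonzero⇒Fin (Fin.zero  , 0≢0) = contradiction refl 0≢0
      Fin⇒nonzero-nonzero⇒Fin (Fin.suc i , _)   = refl

    distanceMonoid : DistanceMonoid n
    distanceMonoid = record
      { Carrier       = Fin (suc n)
      ; _⊕_           = _⊕_
      ; _≤_           = Fin._≤_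
      ; 𝟘             = Fin.zero
      ; isTotalOrder  = Finₚ.≤-isTotalOrder
      ; ≤-⊕           = ≤-⊕
      ; ⊕-mono        = ⊕-mono
      ; ⊕-comm        = ⊕-comm
      ; ⊕-assoc       = ⊕-assoc
      ; ⊕-identityʳ   = ⊕-identityʳ
      ; nonzero-count = mk↔ₛ′ nonzero⇒Fin Fin⇒nonzero (λ _ → refl) Fin⇒nonzero-nonzero⇒Fin
      }

  module _ {n} (D E : BoundedDistanceOperation n) where
    private
      module D = BoundedDistanceOperation D
      module E = BoundedDistanceOperation E

    Iso⇒∙≡ : Iso D.distanceMonoid E.distanceMonoid → ∀ {x y} → x ≤ n → y ≤ n → x D.∙ y ≡ x E.∙ y
    Iso⇒∙≡ iso {x} {y} x≤n y≤n = begin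
      x D.∙ y                 ≡⟨ cong₂ D._∙_ (toℕ-fromℕ< _) (toℕ-fromℕ< _) ⟨
      toℕ x′ D.∙ toℕ y′       ≡⟨ D.toℕ-⊕ x′ y′ ⟨
      toℕ (x′ D.⊕ y′)         ≡⟨ cong toℕ (to≡id (x′ D.⊕ y′)) ⟨
      toℕ (to (x′ D.⊕ y′))    ≡⟨ cong toℕ (Iso.to-⊕ iso x′ y′) ⟩
      toℕ (to x′ E.⊕ to y′)   ≡⟨ cong toℕ (cong₂ E._⊕_ (to≡id x′) (to≡id y′)) ⟩
      toℕ (x′ E.⊕ y′)         ≡⟨ E.toℕ-⊕ x′ y′ ⟩
      toℕ x′ E.∙ toℕ y′       ≡⟨ cong₂ E._∙_ (toℕ-fromℕ< _) (toℕ-fromℕ< _) ⟩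
      x E.∙ y                 ∎
      where
      open ≡-Reasoning
      open Iso iso using (to)
      to≡id : ∀ z → to z ≡ z
      to≡id = reflecting⇒≡id to (Iso.to-reflect iso)
      x′ y′ : Fin (suc n)
      x′ = fromℕ< (s≤s x≤n)
      y′ = fromℕ< (s≤s y≤n)

  module PerturbedSum (n m : ℕ) (e : ℕ → ℕ → ℕ) (e≤1 : ∀ x y → e x y ≤ 1) (5m<n : 5 * m < n) where

    bump : ℕ → ℕ → ℕ
    bump x y = m + 2 * (x + y) + e (x ⊓ y) (x ⊔ y)

    capped : ℕ → ℕ → ℕ
    capped s v with s ≤? m
    ... | yes _ = v
    ... | no  _ = n

    infixl 6 _∙_
    _∙_ : ℕ → ℕ → ℕ
    zero  ∙ y     = y
    suc x ∙ zero  = suc x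
    suc x ∙ suc y = capped (suc x ⊔ suc y) (bump (suc x) (suc y))

    m<n : m < n
    m<n = ≤-<-trans (m≤n*m m 5) 5m<n

    capped-≤ : ∀ {s v} → s ≤ m → capped s v ≡ v
    capped-≤ {s} s≤m with s ≤? m
    ... | yes _   = refl
    ... | no  s≰m = contradiction s≤m s≰m

    capped-> : ∀ {s v} → m < s → capped s v ≡ n
    capped-> {s} m<s with s ≤? m
    ... | yes s≤m = contradiction s≤m (<⇒≱ m<s)
    ... | no  _   = refl

    capped-elim : ∀ (P : ℕ → Set) {s v} → (s ≤ m → P v) → P n → P (capped s v)
    capped-elim P {s} Pv Pn with s ≤? m
    ... | yes s≤m = Pv s≤m
    ... | no  _   = Pn

    bump-comm : ∀ x y → bump x y ≡ bump y x
    bump-comm x y rewrite +-comm x y | ⊓-comm x y | ⊔-comm x y = refl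

    bump-bounded : ∀ {x y} → x ≤ m → y ≤ m → bump x y ≤ n
    bump-bounded {x} {y} x≤m y≤m = begin
      m + 2 * (x + y) + e (x ⊓ y) (x ⊔ y) ≤⟨ +-mono-≤ (+-monoʳ-≤ m (*-monoʳ-≤ 2 (+-mono-≤ x≤m y≤m))) (e≤1 _ _) ⟩
      m + 2 * (m + m) + 1                 ≡⟨ +-comm _ 1 ⟩
      suc (m + 2 * (m + m))               ≡⟨ cong suc (five-times m) ⟩
      suc (5 * m)                         ≤⟨ 5m<n ⟩
      n                                   ∎
      where
      open ≤-Reasoning
      five-times : ∀ k → k + 2 * (k + k) ≡ 5 * k
      five-times = solve-∀

    bump-strict : ∀ {x y t u} → x + y < t + u → bump x y < bump t u
    bump-strict {x} {y} {t} {u} x+y<t+u = begin-strict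
      bump x y            ≤⟨ +-monoʳ-≤ (m + 2 * (x + y)) (e≤1 _ _) ⟩
      m + 2 * (x + y) + 1 <⟨ ≤-reflexive (double-suc m (x + y)) ⟩
      m + 2 * suc (x + y) ≤⟨ +-monoʳ-≤ m (*-monoʳ-≤ 2 x+y<t+u) ⟩
      m + 2 * (t + u)     ≤⟨ m≤m+n _ _ ⟩
      bump t u            ∎
      where
      open ≤-Reasoning
      double-suc : ∀ k s → suc (k + 2 * s + 1) ≡ k + 2 * suc s
      double-suc = solve-∀

    bump-mono : ∀ {x y t u} → x ≤ t → y ≤ u → bump x y ≤ bump t u
    bump-mono {x} {y} {t} {u} x≤t y≤u with x ≟ t | y ≟ u
    ... | yes refl | yes refl = ≤-refl
    ... | no x≢t   | _        = <⇒≤ (bump-strict (+-mono-<-≤ (≤∧≢⇒< x≤t x≢t) y≤u))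
    ... | yes refl | no y≢u   = <⇒≤ (bump-strict (+-monoʳ-< x (≤∧≢⇒< y≤u y≢u)))

    m<bump : ∀ x y → m < bump (suc x) y
    m<bump x y = <-≤-trans (m<m+n m z<s) (m≤m+n _ _)

    ∙-comm : ∀ x y → x ∙ y ≡ y ∙ x
    ∙-comm zero    zero    = refl
    ∙-comm zero    (suc y) = refl
    ∙-comm (suc x) zero    = refl
    ∙-comm (suc x) (suc y) = cong₂ capped (⊔-comm (suc x) (suc y)) (bump-comm (suc x) (suc y))

    ∙-identityʳ : ∀ x → x ∙ 0 ≡ x
    ∙-identityʳ zero    = refl
    ∙-identityʳ (suc x) = refl

    ∙-closed : ∀ {x y} → x ≤ n → y ≤ n → x ∙ y ≤ n
    ∙-closed {zero}  {y}     _   y≤n = y≤n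
    ∙-closed {suc x} {zero}  x≤n _   = x≤n
    ∙-closed {suc x} {suc y} _   _   = capped-elim (_≤ n) small ≤-refl
      where
      small : suc x ⊔ suc y ≤ m → bump (suc x) (suc y) ≤ n
      small xy≤m = bump-bounded (m⊔n≤o⇒m≤o (suc x) (suc y) xy≤m) (m⊔n≤o⇒n≤o (suc x) (suc y) xy≤m)

    m<∙ : ∀ x y → m < suc x ∙ suc y
    m<∙ x y = capped-elim (m <_) (λ _ → m<bump x (suc y)) m<n

    ∙-saturates : ∀ {w} z → m < w → w ∙ suc z ≡ n
    ∙-saturates {suc w} z m<w = capped-> (<-≤-trans m<w (m≤m⊔n (suc w) (suc z)))

    ∙-assoc : ∀ x y z → (x ∙ y) ∙ z ≡ x ∙ (y ∙ z)
    ∙-assoc zero    y       z       = refl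
    ∙-assoc (suc x) zero    z       = refl
    ∙-assoc (suc x) (suc y) zero    = ∙-identityʳ _
    ∙-assoc (suc x) (suc y) (suc z) = begin
      (suc x ∙ suc y) ∙ suc z ≡⟨ ∙-saturates z (m<∙ x y) ⟩
      n                       ≡⟨ ∙-saturates x (m<∙ y z) ⟨
      (suc y ∙ suc z) ∙ suc x ≡⟨ ∙-comm (suc y ∙ suc z) (suc x) ⟩
      suc x ∙ (suc y ∙ suc z) ∎
      where open ≡-Reasoning

    ∙-inflationary : ∀ {x} y → x ≤ n → x ≤ x ∙ y
    ∙-inflationary {zero}  y       _   = z≤n
    ∙-inflationary {suc x} zero    _   = ≤-refl
    ∙-inflationary {suc x} (suc y) x≤n = capped-elim (suc x ≤_) small x≤n
      where
      small : suc x ⊔ suc y ≤ m → suc x ≤ bump (suc x) (suc y)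
      small xy≤m = <⇒≤ (≤-<-trans (m⊔n≤o⇒m≤o (suc x) (suc y) xy≤m) (m<bump x (suc y)))

    ∙-mono : ∀ {x y t u} → x ≤ t → y ≤ u → t ≤ n → u ≤ n → x ∙ y ≤ t ∙ u
    ∙-mono {zero}  {y}     {t}     {u}     _   y≤u _   u≤n = begin
      y     ≤⟨ y≤u ⟩
      u     ≤⟨ ∙-inflationary t u≤n ⟩
      u ∙ t ≡⟨ ∙-comm u t ⟩
      t ∙ u ∎
      where open ≤-Reasoning
    ∙-mono {suc x} {zero}  {t}     {u}     x≤t _   t≤n _   = ≤-trans x≤t (∙-inflationary u t≤n)
    ∙-mono {suc x} {suc y} {suc t} {suc u} x≤t y≤u t≤n u≤n =
      capped-elim (suc x ∙ suc y ≤_) small (∙-closed (≤-trans x≤t t≤n) (≤-trans y≤u u≤n))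
      where
      open ≤-Reasoning
      small : suc t ⊔ suc u ≤ m → suc x ∙ suc y ≤ bump (suc t) (suc u)
      small tu≤m = begin
        suc x ∙ suc y        ≡⟨ capped-≤ (≤-trans (⊔-mono-≤ x≤t y≤u) tu≤m) ⟩
        bump (suc x) (suc y) ≤⟨ bump-mono x≤t y≤u ⟩
        bump (suc t) (suc u) ∎

    ∙-sorted : ∀ {x y} → 0 < x → x ≤ y → y ≤ m → x ∙ y ≡ m + 2 * (x + y) + e x y
    ∙-sorted {suc x} {suc y} _ x≤y y≤m = begin
      suc x ∙ suc y        ≡⟨ capped-≤ (≤-trans (≤-reflexive (m≤n⇒m⊔n≡n x≤y)) y≤m) ⟩
      bump (suc x) (suc y) ≡⟨ cong₂ (λ p q → m + 2 * (suc x + suc y) + e p q) (m≤n⇒m⊓n≡m x≤y) (m≤n⇒m⊔n≡n x≤y) ⟩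
      m + 2 * (suc x + suc y) + e (suc x) (suc y) ∎
      where open ≡-Reasoning

    operation : BoundedDistanceOperation n
    operation = record
      { _∙_         = _∙_
      ; ∙-closed    = ∙-closed
      ; ∙-comm      = ∙-comm
      ; ∙-assoc     = ∙-assoc
      ; ∙-identityʳ = ∙-identityʳ
      ; ∙-mono      = ∙-mono
      }

  indicator : ∀ {A : Set} → Dec A → ℕ
  indicator (yes _) = 1
  indicator (no  _) = 0

  indicator≤1 : ∀ {A : Set} (a? : Dec A) → indicator a? ≤ 1
  indicator≤1 (yes _) = ≤-refl
  indicator≤1 (no  _) = z≤n

  indicator-yes : ∀ {A : Set} (a? : Dec A) → A → indicator a? ≡ 1
  indicator-yes (yes _) _ = refl
  indicator-yes (no ¬a) a = contradiction a ¬a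

  indicator≡1⇒ : ∀ {A : Set} (a? : Dec A) → indicator a? ≡ 1 → A
  indicator≡1⇒ (yes a) _ = a

  funToFin-cong : ∀ {a b} {f g : Fin a → Fin b} → f ≗ g → funToFin f ≡ funToFin g
  funToFin-cong {zero}          _   = refl
  funToFin-cong {suc a} {b} f≗g = cong₂ (combine {b} {b ^ a}) (f≗g Fin.zero) (funToFin-cong (f≗g ∘ Fin.suc))

  finToFun-injective : ∀ {a b} {i j : Fin (b ^ a)} → finToFun {b} {a} i ≗ finToFun j → i ≡ j
  finToFun-injective {a} {b} {i} {j} i≗j = begin
    i                                  ≡⟨ funToFin-finToFin {a} {b} i ⟨
    funToFin (finToFun {b} {a} i)      ≡⟨ funToFin-cong {a} {b} i≗j ⟩
    funToFin (finToFun {b} {a} j)      ≡⟨ funToFin-finToFin {a} {b} j ⟩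
    j                                  ∎
    where open ≡-Reasoning

  module Family (a n : ℕ) (5m<n : 5 * suc (a + a) < n) where

    m : ℕ
    m = suc (a + a)

    Graph : (Fin a → Fin (suc a)) → ℕ → ℕ → Set
    Graph h x y = ∃[ q ] x ≡ suc (toℕ q) × y ≡ suc (a + toℕ (h q))

    graph? : ∀ h x y → Dec (Graph h x y)
    graph? h x y = Finₚ.any? λ q → (x ≟ suc (toℕ q)) ×-dec (y ≟ suc (a + toℕ (h q)))

    graph-functional : ∀ h q {y} → Graph h (suc (toℕ q)) y → y ≡ suc (a + toℕ (h q))
    graph-functional h q (q′ , 1+q≡1+q′ , y≡) with toℕ-injective (suc-injective 1+q≡1+q′)
    ... | refl = y≡

    marking : (Fin a → Fin (suc a)) → ℕ → ℕ → ℕ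
    marking h x y = indicator (graph? h x y)

    marking≤1 : ∀ h x y → marking h x y ≤ 1
    marking≤1 h x y = indicator≤1 (graph? h x y)

    module Op (h : Fin a → Fin (suc a)) = PerturbedSum n m (marking h) (marking≤1 h) 5m<n

    monoid : (Fin a → Fin (suc a)) → DistanceMonoid n
    monoid h = BoundedDistanceOperation.distanceMonoid (Op.operation h)

    Iso⇒≗ : ∀ {h h′} → Iso (monoid h) (monoid h′) → h ≗ h′
    Iso⇒≗ {h} {h′} iso q = toℕ-injective (+-cancelˡ-≡ a _ _ (suc-injective (graph-functional h′ q in-graph′)))
      where
      X = suc (toℕ q)
      Y = suc (a + toℕ (h q))
      X≤Y : X ≤ Y
      X≤Y = s≤s (≤-trans (<⇒≤ (Finₚ.toℕ<n q)) (m≤m+n a _))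
      Y≤m : Y ≤ m
      Y≤m = s≤s (+-monoʳ-≤ a (toℕ≤pred[n] (h q)))
      Y≤n : Y ≤ n
      Y≤n = ≤-trans Y≤m (<⇒≤ (Op.m<n h))
      same-marking : marking h X Y ≡ marking h′ X Y
      same-marking = +-cancelˡ-≡ (m + 2 * (X + Y)) _ _ (begin
        m + 2 * (X + Y) + marking h X Y   ≡⟨ Op.∙-sorted h z<s X≤Y Y≤m ⟨
        Op._∙_ h X Y                      ≡⟨ Iso⇒∙≡ (Op.operation h) (Op.operation h′) iso (≤-trans X≤Y Y≤n) Y≤n ⟩
        Op._∙_ h′ X Y                     ≡⟨ Op.∙-sorted h′ z<s X≤Y Y≤m ⟩
        m + 2 * (X + Y) + marking h′ X Y  ∎)
        where open ≡-Reasoning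
      in-graph′ : Graph h′ X Y
      in-graph′ = indicator≡1⇒ (graph? h′ X Y) (trans (sym same-marking) (indicator-yes (graph? h X Y) (q , refl , refl)))

    atLeastDM : AtLeastDM n (suc a ^ a)
    atLeastDM = monoid ∘ finToFun {suc a} {a} , λ i j i≢j iso → i≢j (finToFun-injective (Iso⇒≗ iso))

  n<[1+n/d]*d : ∀ n d .{{_ : NonZero d}} → n < suc (n / d) * d
  n<[1+n/d]*d n d = begin-strict
    n                 ≡⟨ m≡m%n+[m/n]*n n d ⟩
    n % d + n / d * d <⟨ +-monoˡ-< (n / d * d) (m%n<n n d) ⟩
    d + n / d * d     ∎
    where open ≤-Reasoning

  ^-≤-[1+a]^a : ∀ N .{{_ : NonZero N}} c a {n} → N ^ c ≤ suc a → n ≤ c * a → N ^ n ≤ suc a ^ a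
  ^-≤-[1+a]^a N c a {n} N^c≤1+a n≤ca = begin
    N ^ n       ≤⟨ ^-monoʳ-≤ N n≤ca ⟩
    N ^ (c * a) ≡⟨ ^-*-assoc N c a ⟨
    (N ^ c) ^ a ≤⟨ ^-monoˡ-≤ a N^c≤1+a ⟩
    suc a ^ a   ∎
    where open ≤-Reasoning

  module Sixteenth {P n : ℕ} (1≤P : 1 ≤ P) (P*16<n : P * 16 < n) where

    a : ℕ
    a = n / 16

    P≤a : P ≤ a
    P≤a = subst (_≤ a) (m*n/n≡m P 16) (/-monoˡ-≤ 16 (<⇒≤ P*16<n))

    private
      1≤a : 1 ≤ a
      1≤a = ≤-trans 1≤P P≤a

    5[1+2a]<n : 5 * suc (a + a) < n
    5[1+2a]<n = begin-strict
      5 * suc (a + a) <⟨ ≤-reflexive (lhs a) ⟩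
      6 * 1 + 10 * a  ≤⟨ +-monoˡ-≤ (10 * a) (*-monoʳ-≤ 6 1≤a) ⟩
      6 * a + 10 * a  ≡⟨ rhs a ⟩
      a * 16          ≤⟨ m/n*n≤m n 16 ⟩
      n               ∎
      where
      open ≤-Reasoning
      lhs : ∀ k → suc (5 * suc (k + k)) ≡ 6 * 1 + 10 * k
      lhs = solve-∀
      rhs : ∀ k → 6 * k + 10 * k ≡ k * 16
      rhs = solve-∀

    n≤32a : n ≤ 32 * a
    n≤32a = <⇒≤ (begin-strict
      n               <⟨ n<[1+n/d]*d n 16 ⟩
      16 * 1 + a * 16 ≤⟨ +-monoˡ-≤ (a * 16) (*-monoʳ-≤ 16 1≤a) ⟩
      16 * a + a * 16 ≡⟨ rhs a ⟩
      32 * a          ∎)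
      where
      open ≤-Reasoning
      rhs : ∀ k → 16 * k + k * 16 ≡ 32 * k
      rhs = solve-∀

  [1+N]^32*16>0 : ∀ N → suc N ^ 32 * 16 > 0
  [1+N]^32*16>0 N = <-≤-trans (m^n>0 (suc N) 32) (m≤m*n (suc N ^ 32) 16)

  -- With a = ⌊n/16⌋ one has 5 (2a + 1) < n ≤ 32a, so (a+1)^a ≥ (N+1)^n once a ≥ (N+1)^32.
  atLeastDM-pow : ∀ N n → suc N ^ 32 * 16 < n → ∃[ k ] suc N ^ n ≤ k × AtLeastDM n k
  atLeastDM-pow N n n₀<n =
    suc a ^ a , ^-≤-[1+a]^a (suc N) 32 a (m≤n⇒m≤1+n P≤a) n≤32a , Family.atLeastDM a n 5[1+2a]<n
    where open Sixteenth (m^n>0 (suc N) 32) n₀<n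

open Construction using ([1+N]^32*16>0; atLeastDM-pow)

import Data.Nat as ℕ
import Data.Nat.Properties as ℕₚ
open import Data.Integer as ℤ using (+_; +[1+_]; -[1+_])
import Data.Integer.Properties as ℤₚ
open import Data.Nat.Coprimality as Coprime using (1-coprimeTo)
open import Data.Rational using (ℚ; 0ℚ; _<_; _≤_; _*_)
open import Data.Rational as ℚ using (mkℚ; 1ℚ; *≤*; nonNegative)
import Data.Rational.Properties as ℚₚ
open import Relation.Binary.PropositionalEquality

toℚ≡mkℚ : ∀ k → toℚ k ≡ mkℚ (+ k) 0 (Coprime.sym (1-coprimeTo k))
toℚ≡mkℚ k = ℚₚ.normalize-coprime (Coprime.sym (1-coprimeTo k))

toℚ-* : ∀ j k → toℚ (j ℕ.* k) ≡ toℚ j * toℚ k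
toℚ-* j k rewrite toℚ≡mkℚ j | toℚ≡mkℚ k = cong (ℚ._/ 1) (ℤₚ.pos-* j k)

toℚ-mono-≤ : ∀ {j k} → j ℕ.≤ k → toℚ j ≤ toℚ k
toℚ-mono-≤ {j} {k} j≤k rewrite toℚ≡mkℚ j | toℚ≡mkℚ k =
  *≤* (subst₂ ℤ._≤_ (sym (ℤₚ.*-identityʳ (+ j))) (sym (ℤₚ.*-identityʳ (+ k))) (ℤ.+≤+ j≤k))

toℚ-^ : ∀ N n → toℚ (N ℕ.^ n) ≡ toℚ N ^ℚ n
toℚ-^ N ℕ.zero    = refl
toℚ-^ N (ℕ.suc n) = trans (toℚ-* N (N ℕ.^ n)) (cong (toℚ N *_) (toℚ-^ N n))

^ℚ-nonNeg : ∀ {p} → 0ℚ ≤ p → ∀ n → 0ℚ ≤ p ^ℚ n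
^ℚ-nonNeg 0≤p ℕ.zero    = ℚₚ.nonNegative⁻¹ 1ℚ
^ℚ-nonNeg {p} 0≤p (ℕ.suc n) = begin
  0ℚ         ≡⟨ ℚₚ.*-zeroʳ p ⟨
  p * 0ℚ     ≤⟨ ℚₚ.*-monoˡ-≤-nonNeg p {{nonNegative 0≤p}} (^ℚ-nonNeg 0≤p n) ⟩
  p * p ^ℚ n ∎
  where open ℚₚ.≤-Reasoning

^ℚ-monoˡ-≤ : ∀ {p q} → 0ℚ ≤ p → p ≤ q → ∀ n → p ^ℚ n ≤ q ^ℚ n
^ℚ-monoˡ-≤ 0≤p p≤q ℕ.zero = ℚₚ.≤-refl
^ℚ-monoˡ-≤ {p} {q} 0≤p p≤q (ℕ.suc n) = begin
  p * p ^ℚ n ≤⟨ ℚₚ.*-monoʳ-≤-nonNeg (p ^ℚ n) {{nonNegative (^ℚ-nonNeg 0≤p n)}} p≤q ⟩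
  q * p ^ℚ n ≤⟨ ℚₚ.*-monoˡ-≤-nonNeg q {{nonNegative (ℚₚ.≤-trans 0≤p p≤q)}} (^ℚ-monoˡ-≤ 0≤p p≤q n) ⟩
  q * q ^ℚ n ∎
  where open ℚₚ.≤-Reasoning

≤toℚ-suc : ∀ p → ∃[ N ] p ≤ toℚ (ℕ.suc N)
≤toℚ-suc p@(mkℚ +[1+ k ] _ _) =
  k , subst (p ≤_) (sym (toℚ≡mkℚ (ℕ.suc k))) (*≤* (ℤ.+≤+ (ℕₚ.*-monoʳ-≤ (ℕ.suc k) (ℕ.s≤s ℕ.z≤n))))
≤toℚ-suc p@(mkℚ (+ 0) _ _)    = 0 , subst (p ≤_) (sym (toℚ≡mkℚ 1)) (*≤* (ℤ.+≤+ ℕ.z≤n))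
≤toℚ-suc p@(mkℚ -[1+ _ ] _ _) = 0 , subst (p ≤_) (sym (toℚ≡mkℚ 1)) (*≤* ℤ.-≤+)

^ℚ≤toℚ : ∀ {b N k} n → 0ℚ ≤ b → b ≤ toℚ N → N ℕ.^ n ℕ.≤ k → b ^ℚ n ≤ toℚ k
^ℚ≤toℚ {b} {N} {k} n 0≤b b≤N N^n≤k = begin
  b ^ℚ n         ≤⟨ ^ℚ-monoˡ-≤ 0≤b b≤N n ⟩
  toℚ N ^ℚ n     ≡⟨ toℚ-^ N n ⟨
  toℚ (N ℕ.^ n)  ≤⟨ toℚ-mono-≤ N^n≤k ⟩
  toℚ k          ∎
  where open ℚₚ.≤-Reasoning

atLeastDM-≥-b^n : ∀ {b} N → 0ℚ < b → b ≤ toℚ (ℕ.suc N) → ∀ n → n > ℕ.suc N ℕ.^ 32 ℕ.* 16 →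
                  ∃[ k ] 1ℚ * b ^ℚ n ≤ toℚ k × AtLeastDM n k
atLeastDM-≥-b^n {b} N 0<b b≤1+N n n₀<n =
  let k , [1+N]^n≤k , family = atLeastDM-pow N n n₀<n
  in  k , subst (_≤ toℚ k) (sym (ℚₚ.*-identityˡ (b ^ℚ n))) (^ℚ≤toℚ n (ℚₚ.<⇒≤ 0<b) b≤1+N [1+N]^n≤k) , family

corollary3p4 : (b : ℚ) → 0ℚ < b →
    Σ ℚ (λ c → 0ℚ < c × Σ ℕ (λ n₀ → n₀ > 0 ×
      ((n : ℕ) → n > n₀ →
        Σ ℕ (λ k → (c * (b ^ℚ n)) ≤ toℚ k × AtLeastDM n k))))
corollary3p4 b 0<b =
  let N , b≤1+N = ≤toℚ-suc b
  in  1ℚ , ℚₚ.positive⁻¹ 1ℚ , ℕ.suc N ℕ.^ 32 ℕ.* 16 , [1+N]^32*16>0 N , atLeastDM-≥-b^n N 0<b b≤1+N
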